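{- Let $G$ be a digraph on $n$ vertices and $\mathcal{P}=\{V_{ij}:i,j\in[k]\}$ a partition of $V(G)$. Let $\mathcal{Q}$ be a path system in $G$ such that $e(\mathcal{Q})<|V_{i*}|$ and $e(\mathcal{Q})<|V_{*i}|$ for all $i\in[k]$. Let $G'$ and $\mathcal{P}'=\{V'_{ij}:i,j\in[k]\}$ be the $\mathcal{Q}$-contracted subgraph of $G$ and the $\mathcal{Q}$-contracted partition of $\mathcal{P}$, respectively. Then for all $i\in[k]$, $\delta(G'[V'_{i*},V'_{*i}])\ge\delta(G[V_{i*},V_{*i}])-2e(\mathcal{Q})$.
   Context: $V_{i*}=\bigcup_jV_{ij}$, $V_{*i}=\bigcup_jV_{ji}$. A path system is a set of vertex-disjoint directed paths; $e(\mathcal{Q})$ is its total number of edges. For a directed path $Q$ in $G$ from $v_+\in V_{i_+j_+}$ to $v_-\in V_{i_-j_- }$: the $Q$-contracted subgraph $G'$ is $G-V(Q)$ plus a new vertex $w$ with $N^+_{G'}(w)=N^+_G(v_-)\setminus V(Q)$ and $N^-_{G'}(w)=N^-_G(v_+)\setminus V(Q)$; the $Q$-contracted partition is $\{V'_{ij}\}$ with $V'_{ij}=(V_{ij}\setminus V(Q))\cup\{w\}$ if $(i,j)=(i_-,j_+)$ and $V'_{ij}=V_{ij}\setminus V(Q)$ otherwise. The $\mathcal{Q}$-contracted subgraph/partition are obtained by successively contracting each path of $\mathcal{Q}$. For $U,W\subseteq V(G)$, $G[U,W]$ is the undirected bipartite graph with vertex classes a copy of $U$ and a copy of $W$ (vertices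 of $U\cap W$ appear twice), $u$ adjacent to $w$ iff $uw\in E(G)$; $\delta$ is its minimum degree. -}

module Defs where

open import Data.Nat using (ℕ; zero; suc; _+_; _*_; _∸_; _≤_; _<_)
open import Data.Bool using (Bool; true; false; _∧_; not; if_then_else_)
open import Data.Fin using (Fin)
import Data.Fin as F
open import Data.Maybe using (Maybe; just; nothing)
open import Data.Product using (_×_; _,_; proj₁; proj₂)
open import Data.Sum using (_⊎_; inj₁; inj₂)
open import Data.Sum.Properties using (≡-dec)
open import Data.List using (List; []; _∷_; map; filter; length; concat; allFin; _++_; [_])
open import Data.Nat.ListAction using (sum)
open import Data.Bool.ListAction using (any)
open import Data.Unit using (⊤)
import Data.Bool as B
import Data.List.NonEmpty as L⁺
open import Data.List.NonEmpty using (List⁺; _∷_; head; last; toList; tail)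
open import Data.List.Membership.Propositional using (_∈_)
open import Data.List.Relation.Unary.Unique.Propositional using (Unique)
open import Relation.Nullary.Decidable using (⌊_⌋; Dec)
open import Relation.Binary.PropositionalEquality using (_≡_)
import Data.Nat as N

-- A digraph on vertex set Fin n: a Boolean adjacency relation with no loops
-- (looplessness is imposed as a hypothesis in the statement).
Digraph : ℕ → Set
Digraph n = Fin n → Fin n → Bool

-- A partition {V_ij : i,j ∈ [k]} of V(G): each vertex v lies in V_(P v).
Partition : ℕ → ℕ → Set
Partition n k = Fin n → Fin k × Fin k

rowSize : ∀ {n k} → Partition n k → Fin k → ℕ
rowSize P i = length (filter (λ v → proj₁ (P v) F.≟ i) (allFin _))

colSize : ∀ {n k} → Partition n k → Fin k → ℕ
colSize P i = length (filter (λ v → proj₂ (P v) F.≟ i) (allFin _))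

-- A directed path is given by its (nonempty) vertex sequence from v₊ = head
-- to v₋ = last.
Path : ℕ → Set
Path n = List⁺ (Fin n)

consecutiveEdges : ∀ {n} → Digraph n → List (Fin n) → Set
consecutiveEdges G [] = ⊤
consecutiveEdges G (a ∷ []) = ⊤
consecutiveEdges G (a ∷ b ∷ xs) = (G a b ≡ true) × consecutiveEdges G (b ∷ xs)

IsPath : ∀ {n} → Digraph n → Path n → Set
IsPath G p = consecutiveEdges G (toList p)

-- A path system: a list of directed paths, pairwise vertex-disjoint
-- (and each path has distinct vertices): all vertices listed are distinct.
data AllPaths {n} (G : Digraph n) : List (Path n) → Set where
  []  : AllPaths G []
  _∷_ : ∀ {p ps} → IsPath G p → AllPaths G ps → AllPaths G (p ∷ ps)

IsPathSystem : ∀ {n} → Digraph n → List (Path n) → Set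
IsPathSystem G Q = AllPaths G Q × Unique (concat (map toList Q))

eQ : ∀ {n} → List (Path n) → ℕ
eQ Q = sum (map (λ p → length (tail p)) Q)

-- Graphs arising during successive contraction.
-- Vertices live in the universe Fin n ⊎ ℕ: inj₁ v is an original vertex,
-- inj₂ t is the new vertex created by the t-th contraction.

U : ℕ → Set
U n = Fin n ⊎ ℕ

_≟U_ : ∀ {n} (x y : U n) → Dec (x ≡ y)
_≟U_ = ≡-dec F._≟_ N._≟_

_==_ : ∀ {n} → U n → U n → Bool
x == y = ⌊ x ≟U y ⌋

elemB : ∀ {n} → U n → List (U n) → Bool
elemB x ys = any (λ y → x == y) ys

record State (n k : ℕ) : Set where
  field
    verts : List (U n)
    adj   : U n → U n → Bool
    part  : U n → Maybe (Fin k × Fin k)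

open State public

initial : ∀ {n k} → Digraph n → Partition n k → State n k
initial {n} G P = record
  { verts = map inj₁ (allFin n)
  ; adj   = a
  ; part  = pt
  }
  where
  a : U _ → U _ → Bool
  a (inj₁ x) (inj₁ y) = G x y
  a _ _ = false
  pt : U _ → Maybe _
  pt (inj₁ x) = just (P x)
  pt (inj₂ _) = nothing

contract : ∀ {n k} → State n k → ℕ → List⁺ (U n) → State n k
contract {n} {k} S t Q = record
  { verts = filter (λ x → not (elemB x VQ) B.≟ true) (verts S) ++ [ w ]
  ; adj   = a
  ; part  = pt
  }
  where
  VQ = toList Q
  vp = head Q
  vm = last Q
  w : U n
  w = inj₂ t
  a : U n → U n → Bool
  a x y = if x == w
          then (if y == w then false else (adj S vm y ∧ not (elemB y VQ)))
          else (if y == w then (adj S x vp ∧ not (elemB x VQ)) else adj S x y)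
  combine : Maybe (Fin k × Fin k) → Maybe (Fin k × Fin k) → Maybe (Fin k × Fin k)
  combine (just (i₋ , _)) (just (_ , j₊)) = just (i₋ , j₊)
  combine _ _ = nothing
  pt : U n → Maybe (Fin k × Fin k)
  pt x = if x == w then combine (part S vm) (part S vp) else part S x

contractAll : ∀ {n k} → State n k → ℕ → List (Path n) → State n k
contractAll S t [] = S
contractAll S t (p ∷ ps) = contractAll (contract S t (Data.List.NonEmpty.map inj₁ p)) (suc t) ps
  where import Data.List.NonEmpty

inRow : ∀ {k} → Fin k → Maybe (Fin k × Fin k) → Bool
inRow i (just (a , _)) = ⌊ a F.≟ i ⌋
inRow i nothing = false

inCol : ∀ {k} → Fin k → Maybe (Fin k × Fin k) → Bool
inCol i (just (_ , b)) = ⌊ b F.≟ i ⌋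
inCol i nothing = false

-- degree of (the copy in V_{i*} of) u: number of w ∈ V_{*i} with uw an arc
degRow : ∀ {n k} → State n k → Fin k → U n → ℕ
degRow S i u = length (filter (λ w → (inCol i (part S w) ∧ adj S u w) B.≟ true) (verts S))

-- degree of (the copy in V_{*i} of) w: number of u ∈ V_{i*} with uw an arc
degCol : ∀ {n k} → State n k → Fin k → U n → ℕ
degCol S i w = length (filter (λ u → (inRow i (part S u) ∧ adj S u w) B.≟ true) (verts S))

MinDegAtLeast : ∀ {n k} → State n k → Fin k → ℕ → Set
MinDegAtLeast S i d =
  (∀ u → u ∈ verts S → inRow i (part S u) ≡ true → d ≤ degRow S i u) ×
  (∀ w → w ∈ verts S → inCol i (part S w) ≡ true → d ≤ degCol S i w)

-- Contracting a path Q with e edges to a new vertex w costs every surviving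
-- vertex at most e of its neighbours in G[V_{i*}, V_{*i}]: it loses its
-- neighbours on V(Q), at most e + 1 of them, but whenever it was adjacent to
-- the endpoint v₊ (resp. from v₋) it gains w in exchange, and w lies in the
-- same column (row) class as that endpoint. The new vertex w inherits the
-- out-neighbours of v₋ and the in-neighbours of v₊ off Q, and as G is
-- loopless v₋ and v₊ are not their own neighbours, so w too is at most e
-- short. Contracting the paths one after the other gives the bound
-- δ − e(𝒬), stronger than claimed.
module Submission where

open import Defs
open import Data.Bool using (Bool; true; false; _∧_; _∨_; not)
import Data.Bool as B
open import Data.Bool.Properties using (∧-identityʳ; ∧-zeroʳ)
open import Data.Empty using (⊥; ⊥-elim)
open import Data.Fin using (Fin)
open import Data.List using (List; []; _∷_; _++_; [_]; filter; length; map; concat)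
import Data.List as List
open import Data.List.Membership.Propositional using (_∈_; _∉_)
open import Data.List.Membership.Propositional.Properties
  using (∈-++⁺ˡ; ∈-++⁺ʳ; ∈-++⁻; ∈-filter⁺; ∈-filter⁻; ∈-map⁺; ∈-map⁻; ∈-allFin)
open import Data.List.NonEmpty using (List⁺; _∷_; head; last; tail; toList)
import Data.List.NonEmpty as List⁺
open import Data.List.Properties using (length-map)
import Data.List.Relation.Unary.All as All
open import Data.List.Relation.Unary.Any using (here; there)
open import Data.List.Relation.Unary.Unique.Propositional using (Unique; []; _∷_)
import Data.List.Relation.Unary.Unique.Propositional.Properties as Unique
open import Data.Maybe using (just)
open import Data.Nat using (ℕ; suc; _+_; _*_; _∸_; _≤_; _<_; z≤n; s≤s; s≤s⁻¹)
open import Data.Nat.Properties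
open import Algebra.Properties.CommutativeSemigroup +-commutativeSemigroup using (x∙yz≈z∙xy)
open import Data.Product using (_×_; _,_; proj₁; proj₂; ∃)
open import Data.Sum using (_⊎_; inj₁; inj₂)
open import Data.Sum.Properties using (inj₁-injective)
open import Function using (_∘′_; case_of_)
open import Relation.Nullary using (Dec; yes; no)
open import Relation.Binary.PropositionalEquality using (_≡_; _≢_; refl; sym; trans; cong; cong₂; subst; module ≡-Reasoning)

iverson : Bool → ℕ
iverson true = 1
iverson false = 0

module _ {A : Set} where

  count : (A → Bool) → List A → ℕ
  count p [] = 0
  count p (x ∷ xs) = iverson (p x) + count p xs

  length-filter≡count : ∀ (p : A → Bool) xs → length (filter (λ x → p x B.≟ true) xs) ≡ count p xs
  length-filter≡count p [] = refl
  length-filter≡count p (x ∷ xs) with p x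
  ... | true = cong suc (length-filter≡count p xs)
  ... | false = length-filter≡count p xs

  count-filter : ∀ (q p : A → Bool) xs → count p (filter (λ x → q x B.≟ true) xs) ≡ count (λ x → q x ∧ p x) xs
  count-filter q p [] = refl
  count-filter q p (x ∷ xs) with q x
  ... | true = cong (iverson (p x) +_) (count-filter q p xs)
  ... | false = count-filter q p xs

  count-++ : ∀ (p : A → Bool) xs ys → count p (xs ++ ys) ≡ count p xs + count p ys
  count-++ p [] ys = refl
  count-++ p (x ∷ xs) ys = trans (cong (iverson (p x) +_) (count-++ p xs ys)) (sym (+-assoc (iverson (p x)) _ _))

  count-cong : ∀ {p r : A → Bool} xs → (∀ {x} → x ∈ xs → p x ≡ r x) → count p xs ≡ count r xs
  count-cong [] eq = refl
  count-cong (x ∷ xs) eq = cong₂ _+_ (cong iverson (eq (here refl))) (count-cong xs (eq ∘′ there))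

  count-false : ∀ xs → count (λ _ → false) xs ≡ 0
  count-false [] = refl
  count-false (x ∷ xs) = count-false xs

  count-split : ∀ (q p : A → Bool) xs → count p xs ≡ count (λ x → not (q x) ∧ p x) xs + count (λ x → q x ∧ p x) xs
  count-split q p [] = refl
  count-split q p (x ∷ xs) with q x | p x
  ... | true | true = trans (cong suc (count-split q p xs)) (sym (+-suc _ _))
  ... | true | false = count-split q p xs
  ... | false | true = cong suc (count-split q p xs)
  ... | false | false = count-split q p xs

  count-∧≤ : ∀ (q p : A → Bool) xs → count (λ x → q x ∧ p x) xs ≤ count q xs
  count-∧≤ q p [] = z≤n
  count-∧≤ q p (x ∷ xs) with q x | p x
  ... | true | true = s≤s (count-∧≤ q p xs)
  ... | true | false = m≤n⇒m≤1+n (count-∧≤ q p xs)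
  ... | false | _ = count-∧≤ q p xs

  count-∧< : ∀ (q p : A → Bool) {z} xs → z ∈ xs → q z ≡ true → p z ≡ false →
             count (λ x → q x ∧ p x) xs < count q xs
  count-∧< q p (x ∷ xs) (here refl) qx px rewrite qx | px = s≤s (count-∧≤ q p xs)
  count-∧< q p (x ∷ xs) (there z∈xs) qz pz with q x | p x | count-∧< q p xs z∈xs qz pz
  ... | true | true | lt = s≤s lt
  ... | true | false | lt = m≤n⇒m≤1+n lt
  ... | false | _ | lt = lt

  count-∨≤ : ∀ (p r : A → Bool) xs → count (λ x → p x ∨ r x) xs ≤ count p xs + count r xs
  count-∨≤ p r [] = z≤n
  count-∨≤ p r (x ∷ xs) with p x | r x | count-∨≤ p r xs
  ... | true | true | le = s≤s (≤-trans (m≤n⇒m≤1+n le) (≤-reflexive (sym (+-suc _ _))))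
  ... | true | false | le = s≤s le
  ... | false | true | le = ≤-trans (s≤s le) (≤-reflexive (sym (+-suc _ _)))
  ... | false | false | le = le

module _ {n : ℕ} where

  ==-refl : (x : U n) → (x == x) ≡ true
  ==-refl x with x ≟U x
  ... | yes _ = refl
  ... | no x≢x = ⊥-elim (x≢x refl)

  ≢⇒==-false : {x y : U n} → x ≢ y → (x == y) ≡ false
  ≢⇒==-false {x} {y} x≢y with x ≟U y
  ... | yes x≡y = ⊥-elim (x≢y x≡y)
  ... | no _ = refl

  ∈⇒elemB≡true : {y : U n} {ys : List (U n)} → y ∈ ys → elemB y ys ≡ true
  ∈⇒elemB≡true {y} (here refl) rewrite ==-refl y = refl
  ∈⇒elemB≡true {y} {x ∷ _} (there y∈ys) with y == x
  ... | true = refl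
  ... | false = ∈⇒elemB≡true y∈ys

  ∉⇒elemB≡false : {y : U n} {ys : List (U n)} → y ∉ ys → elemB y ys ≡ false
  ∉⇒elemB≡false {ys = []} y∉ys = refl
  ∉⇒elemB≡false {y} {x ∷ _} y∉ys rewrite ≢⇒==-false (y∉ys ∘′ here) = ∉⇒elemB≡false (y∉ys ∘′ there)

  ∉⇒count-==≡0 : ∀ {v} {xs : List (U n)} → v ∉ xs → count (_== v) xs ≡ 0
  ∉⇒count-==≡0 {xs = []} _ = refl
  ∉⇒count-==≡0 {v} {x ∷ _} v∉xs
    rewrite ≢⇒==-false {x} {v} (λ x≡v → v∉xs (here (sym x≡v))) = ∉⇒count-==≡0 (v∉xs ∘′ there)

  count-==≤1 : ∀ v {xs : List (U n)} → Unique xs → count (_== v) xs ≤ 1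
  count-==≤1 v [] = z≤n
  count-==≤1 v {x ∷ xs} unique@(_ ∷ unique-xs) with x ≟U v
  ... | yes refl = ≤-reflexive (cong suc (∉⇒count-==≡0 (Unique.Unique[x∷xs]⇒x∉xs unique)))
  ... | no _ = count-==≤1 v unique-xs

  count-elemB≤length : ∀ {xs : List (U n)} (ys : List (U n)) → Unique xs → count (λ x → elemB x ys) xs ≤ length ys
  count-elemB≤length {xs} [] _ = ≤-reflexive (count-false xs)
  count-elemB≤length {xs} (y ∷ ys) unique = begin
    count (λ x → (x == y) ∨ elemB x ys) xs         ≤⟨ count-∨≤ (_== y) (λ x → elemB x ys) xs ⟩
    count (_== y) xs + count (λ x → elemB x ys) xs ≤⟨ +-mono-≤ (count-==≤1 y unique) (count-elemB≤length ys unique) ⟩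
    suc (length ys)                                ∎
    where open ≤-Reasoning

  -- In a contraction, the hit at z is paid back by the new vertex that replaces z.
  count-remove≤ : ∀ (f : U n → Bool) {xs : List (U n)} (ys : List⁺ (U n)) {z} →
    Unique xs → z ∈ xs → z ∈ toList ys →
    count f xs ≤ count (λ x → not (elemB x (toList ys)) ∧ f x) xs + (iverson (f z) + length (tail ys))
  count-remove≤ f {xs} ys {z} unique z∈xs z∈ys = begin
    count f xs                          ≡⟨ count-split inYs f xs ⟩
    count (λ x → not (inYs x) ∧ f x) xs + count (λ x → inYs x ∧ f x) xs
                                        ≤⟨ +-monoʳ-≤ (count (λ x → not (inYs x) ∧ f x) xs) on-ys ⟩
    count (λ x → not (inYs x) ∧ f x) xs + (iverson (f z) + length (tail ys)) ∎
    where
    open ≤-Reasoning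
    inYs : U n → Bool
    inYs x = elemB x (toList ys)
    ys-hits : count inYs xs ≤ suc (length (tail ys))
    ys-hits = count-elemB≤length (toList ys) unique
    on-ys : count (λ x → inYs x ∧ f x) xs ≤ iverson (f z) + length (tail ys)
    on-ys with f z in fz
    ... | true = ≤-trans (count-∧≤ inYs f xs) ys-hits
    ... | false = s≤s⁻¹ (≤-trans (count-∧< inYs f xs z∈xs (∈⇒elemB≡true z∈ys) fz) ys-hits)

module _ {A : Set} where

  head∈toList : (xs : List⁺ A) → head xs ∈ toList xs
  head∈toList (x ∷ xs) = here refl

  last∈toList : (xs : List⁺ A) → last xs ∈ toList xs
  last∈toList (x ∷ xs) with List.initLast xs
  ... | [] = here refl
  ... | ys List.∷ʳ′ y = there (∈-++⁺ʳ ys (here refl))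

module Contraction {n k : ℕ} (S : State n k) (t : ℕ) (Q : List⁺ (U n)) where

  w : U n
  w = inj₂ t

  inQ : U n → Bool
  inQ x = elemB x (toList Q)

  S′ : State n k
  S′ = contract S t Q

  e : ℕ
  e = length (tail Q)

  part-old : ∀ {y} → y ≢ w → part S′ y ≡ part S y
  part-old y≢w rewrite ≢⇒==-false y≢w = refl

  part-new : ∀ {c₊ c₋} → part S (head Q) ≡ just c₊ → part S (last Q) ≡ just c₋ →
             part S′ w ≡ just (proj₁ c₋ , proj₂ c₊)
  part-new part-head part-last rewrite ==-refl w | part-head | part-last = refl

  adj-old : ∀ {x y} → x ≢ w → y ≢ w → adj S′ x y ≡ adj S x y
  adj-old x≢w y≢w rewrite ≢⇒==-false x≢w | ≢⇒==-false y≢w = refl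

  adj-to-new : ∀ {x} → x ≢ w → adj S′ x w ≡ (adj S x (head Q) ∧ not (inQ x))
  adj-to-new x≢w rewrite ≢⇒==-false x≢w | ==-refl w = refl

  adj-from-new : ∀ {y} → y ≢ w → adj S′ w y ≡ (adj S (last Q) y ∧ not (inQ y))
  adj-from-new y≢w rewrite ≢⇒==-false y≢w | ==-refl w = refl

  adj-new-new : adj S′ w w ≡ false
  adj-new-new rewrite ==-refl w = refl

  verts-contract⁻ : ∀ {u} → u ∈ verts S′ → (u ∈ verts S × inQ u ≡ false) ⊎ u ≡ w
  verts-contract⁻ u∈S′ with ∈-++⁻ (filter (λ x → not (inQ x) B.≟ true) (verts S)) u∈S′
  ... | inj₂ (here u≡w) = inj₂ u≡w
  ... | inj₁ u∈filter with ∈-filter⁻ (λ x → not (inQ x) B.≟ true) u∈filter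
  ...   | u∈S , u∉Q = inj₁ (u∈S , not-injective u∉Q)
    where
    not-injective : ∀ {b} → not b ≡ true → b ≡ false
    not-injective {false} _ = refl

  count-verts : ∀ g → count g (verts S′) ≡ count (λ x → not (inQ x) ∧ g x) (verts S) + iverson (g w)
  count-verts g = begin
    count g (verts S′)
      ≡⟨ count-++ g (filter (λ x → not (inQ x) B.≟ true) (verts S)) [ w ] ⟩
    count g (filter (λ x → not (inQ x) B.≟ true) (verts S)) + (iverson (g w) + 0)
      ≡⟨ cong₂ _+_ (count-filter (not ∘′ inQ) g (verts S)) (+-identityʳ (iverson (g w))) ⟩
    count (λ x → not (inQ x) ∧ g x) (verts S) + iverson (g w) ∎
    where open ≡-Reasoning

  module _ (unique : Unique (verts S)) (w∉S : w ∉ verts S) (loopless : ∀ x → adj S x x ≡ false)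
           (head∈S : head Q ∈ verts S) (last∈S : last Q ∈ verts S)
           {c₊ c₋ : Fin k × Fin k} (part-head : part S (head Q) ≡ just c₊) (part-last : part S (last Q) ≡ just c₋)
           where

    ≢w : ∀ {y} → y ∈ verts S → y ≢ w
    ≢w y∈S refl = w∉S y∈S

    ∧-off-Q : ∀ a {y} → inQ y ≡ false → (a ∧ not (inQ y)) ≡ a
    ∧-off-Q a y∉Q rewrite y∉Q = ∧-identityʳ a

    ∧-false : ∀ a {b} → b ≡ false → (a ∧ b) ≡ false
    ∧-false a refl = ∧-zeroʳ a

    row-new : ∀ i → inRow i (part S′ w) ≡ inRow i (part S (last Q))
    row-new i rewrite part-new part-head part-last | part-last = refl

    col-new : ∀ i → inCol i (part S′ w) ≡ inCol i (part S (head Q))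
    col-new i rewrite part-new part-head part-last | part-head = refl

    degree-transfer : ∀ {D} f g {z} → z ∈ verts S → z ∈ toList Q →
      (∀ {y} → y ∈ verts S → inQ y ≡ false → g y ≡ f y) → g w ≡ f z →
      D ≤ length (filter (λ x → f x B.≟ true) (verts S)) →
      D ∸ e ≤ length (filter (λ x → g x B.≟ true) (verts S′))
    degree-transfer {D} f g {z} z∈S z∈Q g≡f gw≡fz D≤f = m≤n+o⇒m∸n≤o D e (begin
      D                                                    ≤⟨ D≤f ⟩
      length (filter (λ x → f x B.≟ true) (verts S))       ≡⟨ length-filter≡count f (verts S) ⟩
      count f (verts S)                                    ≤⟨ count-remove≤ f Q unique z∈S z∈Q ⟩
      outside f + (iverson (f z) + e)                      ≡⟨ cong₂ (λ a b → a + (iverson b + e)) outside-agree (sym gw≡fz) ⟩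
      outside g + (iverson (g w) + e)                      ≡⟨ x∙yz≈z∙xy (outside g) (iverson (g w)) e ⟩
      e + (outside g + iverson (g w))                      ≡⟨ cong (e +_) (sym (count-verts g)) ⟩
      e + count g (verts S′)                               ≡⟨ cong (e +_) (sym (length-filter≡count g (verts S′))) ⟩
      e + length (filter (λ x → g x B.≟ true) (verts S′))  ∎)
      where
      open ≤-Reasoning
      outside : (U n → Bool) → ℕ
      outside h = count (λ x → not (inQ x) ∧ h x) (verts S)
      outside-agree : outside f ≡ outside g
      outside-agree = count-cong (verts S) agree
        where
        agree : ∀ {x} → x ∈ verts S → (not (inQ x) ∧ f x) ≡ (not (inQ x) ∧ g x)
        agree {x} x∈S with inQ x in x∉Q
        ... | true = refl
        ... | false = sym (g≡f x∈S x∉Q)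

    contract-MinDegAtLeast : ∀ i {D} → MinDegAtLeast S i D → MinDegAtLeast S′ i (D ∸ e)
    contract-MinDegAtLeast i {D} (rows , cols) = rows′ , cols′
      where
      rows′ : ∀ u → u ∈ verts S′ → inRow i (part S′ u) ≡ true → D ∸ e ≤ degRow S′ i u
      rows′ u u∈S′ u-row with verts-contract⁻ u∈S′
      ... | inj₁ (u∈S , u∉Q) =
        degree-transfer (λ y → inCol i (part S y) ∧ adj S u y) _ head∈S (head∈toList Q)
          (λ y∈S _ → cong₂ _∧_ (cong (inCol i) (part-old (≢w y∈S))) (adj-old (≢w u∈S) (≢w y∈S)))
          (cong₂ _∧_ (col-new i) (trans (adj-to-new (≢w u∈S)) (∧-off-Q _ u∉Q)))
          (rows u u∈S (trans (cong (inRow i) (sym (part-old (≢w u∈S)))) u-row))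
      ... | inj₂ refl =
        degree-transfer (λ y → inCol i (part S y) ∧ adj S (last Q) y) _ last∈S (last∈toList Q)
          (λ y∈S y∉Q → cong₂ _∧_ (cong (inCol i) (part-old (≢w y∈S))) (trans (adj-from-new (≢w y∈S)) (∧-off-Q _ y∉Q)))
          (trans (∧-false _ adj-new-new) (sym (∧-false _ (loopless (last Q)))))
          (rows (last Q) last∈S (trans (sym (row-new i)) u-row))
      cols′ : ∀ u → u ∈ verts S′ → inCol i (part S′ u) ≡ true → D ∸ e ≤ degCol S′ i u
      cols′ u u∈S′ u-col with verts-contract⁻ u∈S′
      ... | inj₁ (u∈S , u∉Q) =
        degree-transfer (λ y → inRow i (part S y) ∧ adj S y u) _ last∈S (last∈toList Q)
          (λ y∈S _ → cong₂ _∧_ (cong (inRow i) (part-old (≢w y∈S))) (adj-old (≢w y∈S) (≢w u∈S)))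
          (cong₂ _∧_ (row-new i) (trans (adj-from-new (≢w u∈S)) (∧-off-Q _ u∉Q)))
          (cols u u∈S (trans (cong (inCol i) (sym (part-old (≢w u∈S)))) u-col))
      ... | inj₂ refl =
        degree-transfer (λ y → inRow i (part S y) ∧ adj S y (head Q)) _ head∈S (head∈toList Q)
          (λ y∈S y∉Q → cong₂ _∧_ (cong (inRow i) (part-old (≢w y∈S))) (trans (adj-to-new (≢w y∈S)) (∧-off-Q _ y∉Q)))
          (trans (∧-false _ adj-new-new) (sym (∧-false _ (loopless (head Q)))))
          (cols (head Q) head∈S (trans (sym (col-new i)) u-col))

module _ {A : Set} {ys : List A} where

  unique-++⁻ʳ : (xs : List A) → Unique (xs ++ ys) → Unique ys
  unique-++⁻ʳ [] unique = unique
  unique-++⁻ʳ (x ∷ xs) (_ ∷ unique) = unique-++⁻ʳ xs unique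

  unique-++⇒disjoint : (xs : List A) → Unique (xs ++ ys) → ∀ {v} → v ∈ ys → v ∉ xs
  unique-++⇒disjoint (x ∷ xs) (x∉ ∷ _) v∈ys (here refl) = All.lookup x∉ (∈-++⁺ʳ xs v∈ys) refl
  unique-++⇒disjoint (x ∷ xs) (_ ∷ unique) v∈ys (there v∈xs) = unique-++⇒disjoint xs unique v∈ys v∈xs

MinDegAtLeast-weaken : ∀ {n k} (S : State n k) i {D D′} → D′ ≤ D → MinDegAtLeast S i D → MinDegAtLeast S i D′
MinDegAtLeast-weaken S i D′≤D (rows , cols) =
  (λ u u∈S u-row → ≤-trans D′≤D (rows u u∈S u-row)) , (λ u u∈S u-col → ≤-trans D′≤D (cols u u∈S u-col))

module _ {n k : ℕ} (P : Partition n k) where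

  record ContractionInvariant (S : State n k) (t : ℕ) (Qs : List (Path n)) : Set where
    field
      unique-verts  : Unique (verts S)
      fresh         : ∀ {t′} → t ≤ t′ → inj₂ t′ ∉ verts S
      loopless      : ∀ x → adj S x x ≡ false
      part-original : ∀ x → part S (inj₁ x) ≡ just (P x)
      unique-paths  : Unique (concat (map toList Qs))
      paths⊆verts   : ∀ {v} → v ∈ concat (map toList Qs) → inj₁ v ∈ verts S

  initial-invariant : ∀ {G : Digraph n} {Qs} → (∀ v → G v v ≡ false) → Unique (concat (map toList Qs)) →
                      ContractionInvariant (initial G P) 0 Qs
  initial-invariant {G} G-loopless unique-Qs = record
    { unique-verts  = Unique.map⁺ inj₁-injective (Unique.allFin⁺ n)
    ; fresh         = λ _ t′∈G → case ∈-map⁻ inj₁ t′∈G of λ ()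
    ; loopless      = loopless
    ; part-original = λ _ → refl
    ; unique-paths  = unique-Qs
    ; paths⊆verts   = λ {v} _ → ∈-map⁺ inj₁ (∈-allFin v)
    }
    where
    loopless : ∀ x → adj (initial G P) x x ≡ false
    loopless (inj₁ v) = G-loopless v
    loopless (inj₂ _) = refl

  contract-invariant : ∀ {S t p ps} → ContractionInvariant S t (p ∷ ps) →
                       ContractionInvariant (contract S t (List⁺.map inj₁ p)) (suc t) ps
  contract-invariant {S} {t} {p@(x ∷ xs)} {ps} inv = record
    { unique-verts  = Unique.++⁺ (Unique.filter⁺ survives? unique-verts) (All.[] ∷ []) w-new
    ; fresh         = fresh′
    ; loopless      = loopless′
    ; part-original = λ v → trans (part-old (λ ())) (part-original v)
    ; unique-paths  = unique-++⁻ʳ (toList p) unique-paths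
    ; paths⊆verts   = paths⊆verts′
    }
    where
    open ContractionInvariant inv
    open Contraction S t (List⁺.map inj₁ p)
    survives? = λ y → not (inQ y) B.≟ true
    w-new : ∀ {y} → y ∈ filter survives? (verts S) × y ∈ [ w ] → ⊥
    w-new (y∈S′ , here refl) = fresh ≤-refl (proj₁ (∈-filter⁻ survives? y∈S′))
    fresh′ : ∀ {t′} → suc t ≤ t′ → inj₂ t′ ∉ verts S′
    fresh′ t<t′ t′∈S′ with verts-contract⁻ t′∈S′
    ... | inj₁ (t′∈S , _) = fresh (≤-trans (n≤1+n t) t<t′) t′∈S
    ... | inj₂ refl = 1+n≰n t<t′
    loopless′ : ∀ y → adj S′ y y ≡ false
    loopless′ y = by-cases (y ≟U w)
      where
      by-cases : Dec (y ≡ w) → adj S′ y y ≡ false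
      by-cases (yes refl) = adj-new-new
      by-cases (no y≢w) = trans (adj-old y≢w y≢w) (loopless y)
    paths⊆verts′ : ∀ {v} → v ∈ concat (map toList ps) → inj₁ v ∈ verts S′
    paths⊆verts′ {v} v∈ps =
      ∈-++⁺ˡ (∈-filter⁺ survives? (paths⊆verts (∈-++⁺ʳ (toList p) v∈ps)) (cong not (∉⇒elemB≡false v∉p)))
      where
      v∉p : inj₁ v ∉ toList (List⁺.map inj₁ p)
      v∉p v∈p with ∈-map⁻ inj₁ v∈p
      ... | _ , v∈p′ , refl = unique-++⇒disjoint (toList p) unique-paths v∈ps v∈p′

  contractAll-MinDegAtLeast : ∀ {S t} Qs i {D} → ContractionInvariant S t Qs →
    MinDegAtLeast S i D → MinDegAtLeast (contractAll S t Qs) i (D ∸ eQ Qs)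
  contractAll-MinDegAtLeast [] i _ δ≥D = δ≥D
  contractAll-MinDegAtLeast {S} {t} (p@(x ∷ xs) ∷ ps) i {D} inv δ≥D =
    subst (MinDegAtLeast (contractAll S′ (suc t) ps) i) (∸-+-assoc D (length xs) (eQ ps))
      (contractAll-MinDegAtLeast ps i (contract-invariant inv)
        (subst (λ m → MinDegAtLeast S′ i (D ∸ m)) (length-map inj₁ xs)
          (contract-MinDegAtLeast unique-verts (fresh ≤-refl) loopless
            (paths⊆verts (here refl)) last∈S (part-original x) (proj₂ last-classified) i δ≥D)))
    where
    open ContractionInvariant inv
    Q′ = List⁺.map inj₁ p
    open Contraction S t Q′
    last∈S : last Q′ ∈ verts S
    last∈S with ∈-map⁻ inj₁ (last∈toList Q′)
    ... | v , v∈p , last≡v rewrite last≡v = paths⊆verts (∈-++⁺ˡ v∈p)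
    last-classified : ∃ λ c → part S (last Q′) ≡ just c
    last-classified with ∈-map⁻ inj₁ (last∈toList Q′)
    ... | v , _ , last≡v rewrite last≡v = P v , part-original v

proposition5p2 : (n k : ℕ) (G : Digraph n) → (∀ v → G v v ≡ false) →
    (P : Partition n k) (Q : List (Path n)) → IsPathSystem G Q →
    (∀ i → eQ Q < rowSize P i) → (∀ i → eQ Q < colSize P i) →
    (i : Fin k) (d : ℕ) →
    MinDegAtLeast (initial G P) i d →
    MinDegAtLeast (contractAll (initial G P) 0 Q) i (d ∸ 2 * eQ Q)
proposition5p2 n k G G-loopless P Q (_ , unique-Q) _ _ i d δ≥d =
  MinDegAtLeast-weaken (contractAll (initial G P) 0 Q) i (∸-monoʳ-≤ d (m≤m+n (eQ Q) (eQ Q + 0)))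
    (contractAll-MinDegAtLeast P Q i (initial-invariant P G-loopless unique-Q) δ≥d)
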